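{- Let $\ell\ge 1$ and let $C=(w_1,\dots,w_{2\ell+1})$ be a semi-valid tuple in $\Omega_n$. If $C$ is not $(i,2\ell+1)$-consecutive for any $i$, then there exist $i$ and $k$ with $1\le k\le\ell$ such that $C$ is $(i,k)$-consecutive and both $C_{i,k,1}$ and $C_{i,k,-1}$ are semi-valid.
   Context: $\Omega_n=\{v_0,\dots,v_{n-1}\}$ carries the cyclic (clockwise) order $v_0<\dots<v_{n-1}<v_0$; indices of $v$ are modulo $n$ and indices of $w$ modulo $2\ell+1$. A tuple $C=(w_1,\dots,w_{2\ell+1})$ of distinct vertices is semi-valid if $w_1<w_3<\dots<w_{2\ell+1}<w_2<\dots<w_{2\ell}<w_1$ in the cyclic order (they appear clockwise in this order). $C$ is $(i,k)$-consecutive if there is $j$ with $w_{i+2s}=v_{j+s}$ for all $0\le s<k$; in that case, for an integer $m$, $C_{i,k,m}=(w'_1,\dots,w'_{2\ell+1})$ where $w'_{i+2s}=v_{j+s+m}$ for $0\le s<k$ and $w'_p=w_p$ for all other $p$. -}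

module Defs where

open import Data.Nat using (ℕ; zero; suc; _+_; _*_; _<_; NonZero)
open import Data.Nat.DivMod using (_mod_)
open import Data.Integer using (ℤ; +_)
import Data.Integer as ℤ
open import Data.Integer.DivMod using (_%ℕ_)
open import Data.Fin using (Fin; toℕ; _≟_)
open import Data.Product using (∃; ∃-syntax; _×_)
open import Relation.Binary.PropositionalEquality using (_≡_)
open import Relation.Nullary using (yes; no)
open import Function.Definitions using (Injective)

-- Vertex v_j of Ω_n (index j taken modulo n).  Ω_n is modelled as Fin n,
-- with v_j the element j mod n; the clockwise order is the order of toℕ,
-- read cyclically.
vtx : (n : ℕ) .{{_ : NonZero n}} → ℤ → Fin n
vtx n j = (j %ℕ n) mod n

-- A (2ℓ+1)-tuple of vertices: w p represents w_p, with indices modulo 2ℓ+1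
-- (so the paper's w_{2ℓ+1} is stored at position 0).
Tuple : (n ℓ : ℕ) → Set
Tuple n ℓ = Fin (suc (2 * ℓ)) → Fin n

W : {n : ℕ} (ℓ : ℕ) → Tuple n ℓ → ℕ → Fin n
W ℓ w p = w (p mod suc (2 * ℓ))

-- The periodic sequence a_0, a_1, ... (period m) appears clockwise in the
-- order a_0, a_1, ..., a_{m-1}: some rotation of it is strictly increasing.
ClockwiseOrder : {n : ℕ} (m : ℕ) → (ℕ → Fin n) → Set
ClockwiseOrder m a =
  ∃[ r ] (r < m × (∀ s t → s < t → t < m → toℕ (a (r + s)) < toℕ (a (r + t))))

-- Semi-valid: distinct, and w_1 < w_3 < ... < w_{2ℓ+1} < w_2 < ... < w_{2ℓ} < w_1
-- clockwise; this list is exactly w_{1+2s}, s = 0, ..., 2ℓ (indices mod 2ℓ+1).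
SemiValid : {n : ℕ} (ℓ : ℕ) → Tuple n ℓ → Set
SemiValid ℓ w = Injective _≡_ _≡_ w × ClockwiseOrder (suc (2 * ℓ)) (λ s → W ℓ w (1 + 2 * s))

ConsecutiveAt : (n : ℕ) .{{_ : NonZero n}} (ℓ : ℕ) → Tuple n ℓ → (i k : ℕ) → ℤ → Set
ConsecutiveAt n ℓ w i k j = ∀ s → s < k → W ℓ w (i + 2 * s) ≡ vtx n (j ℤ.+ + s)

Consecutive : (n : ℕ) .{{_ : NonZero n}} (ℓ : ℕ) → Tuple n ℓ → (i k : ℕ) → Set
Consecutive n ℓ w i k = ∃[ j ] ConsecutiveAt n ℓ w i k j

setAt : {n : ℕ} (ℓ : ℕ) → Tuple n ℓ → Fin (suc (2 * ℓ)) → Fin n → Tuple n ℓ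
setAt ℓ w q x p with p ≟ q
... | yes _ = x
... | no _ = w p

-- C_{i,k,m} (relative to the witness j of consecutiveness): positions
-- i+2s (0 ≤ s < k) are set to v_{j+s+m}, all other positions unchanged.
shiftC : (n : ℕ) .{{_ : NonZero n}} (ℓ : ℕ) → Tuple n ℓ → (i k : ℕ) → (j m : ℤ) → Tuple n ℓ
shiftC n ℓ w i zero j m = w
shiftC n ℓ w i (suc k) j m =
  setAt ℓ (shiftC n ℓ w i k j m) ((i + 2 * k) mod suc (2 * ℓ)) (vtx n (j ℤ.+ + k ℤ.+ m))

{-# OPTIONS --safe #-}
-- Read w_1, w_3, …, w_{2ℓ+1} clockwise and lift their positions to a strictly
-- increasing sequence c of naturals with c (t + 2ℓ + 1) = c t + n.  As C is not
-- (i, 2ℓ+1)-consecutive, every 2ℓ successive gaps of c contain one larger than 1,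
-- so one period of c splits into at least two maximal runs of consecutive values,
-- and one run has at most ℓ elements.  The larger gaps around that run leave room
-- to move it one step in either direction while c stays strictly increasing
-- within one turn of the circle, which is exactly semi-validity.
module Submission where

open import Defs
open import Data.Nat using (ℕ; zero; suc; _+_; _*_; _∸_; _≤_; _<_; z≤n; s≤s; s≤s⁻¹; NonZero; >-nonZero; _%_; _/_; _≤?_; _<?_)
open import Data.Nat.Properties hiding (_≟_)
open import Data.Nat.Properties using () renaming (_≟_ to _≟ℕ_)
open import Data.Nat.DivMod
open import Data.Nat.Divisibility using (divides; ∣⇒≤; n∣m*n)
open import Data.Nat.Tactic.RingSolver using (solve-∀)
open import Data.Fin using (Fin; toℕ; _≟_)
open import Data.Fin.Properties using (toℕ-injective; toℕ-fromℕ<; toℕ<n)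
open import Data.Product using (∃; ∃-syntax; _×_; _,_)
open import Data.Sum using (inj₁; inj₂)
open import Relation.Nullary using (¬_; ¬?; yes; no; contradiction)
open import Relation.Nullary.Decidable using (decidable-stable)
open import Relation.Unary using (Decidable)
open import Relation.Binary.PropositionalEquality
open import Relation.Binary.Definitions using (tri<; tri≈; tri>)
open import Function.Definitions using (Injective)
open import Data.Integer using (ℤ; +_; -_)
import Data.Integer as ℤ
import Data.Integer.Properties as ℤP

toℕ-mod : ∀ x N .{{_ : NonZero N}} → toℕ (x mod N) ≡ x % N
toℕ-mod x N = toℕ-fromℕ< (m%n<n x N)

%≡⇒mod≡ : ∀ x y N .{{_ : NonZero N}} → x % N ≡ y % N → x mod N ≡ y mod N
%≡⇒mod≡ x y N e = toℕ-injective (trans (toℕ-mod x N) (trans e (sym (toℕ-mod y N))))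

mod≡⇒%≡ : ∀ x y N .{{_ : NonZero N}} → x mod N ≡ y mod N → x % N ≡ y % N
mod≡⇒%≡ x y N e = trans (sym (toℕ-mod x N)) (trans (cong toℕ e) (toℕ-mod y N))

toℕ-vtx : ∀ n .{{_ : NonZero n}} x → toℕ (vtx n (+ x)) ≡ x % n
toℕ-vtx n x = trans (toℕ-mod (x % n) n) (m%n%n≡m%n x n)

+-congˡ-% : ∀ c a b N .{{_ : NonZero N}} → a % N ≡ b % N → (c + a) % N ≡ (c + b) % N
+-congˡ-% c a b N e = begin
  (c + a) % N            ≡⟨ %-distribˡ-+ c a N ⟩
  (c % N + a % N) % N    ≡⟨ cong (λ z → (c % N + z) % N) e ⟩
  (c % N + b % N) % N    ≡⟨ %-distribˡ-+ c b N ⟨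
  (c + b) % N            ∎
  where open ≡-Reasoning

*-congˡ-% : ∀ c a b N .{{_ : NonZero N}} → a % N ≡ b % N → (c * a) % N ≡ (c * b) % N
*-congˡ-% c a b N e = begin
  (c * a) % N            ≡⟨ %-distribˡ-* c a N ⟩
  (c % N * (a % N)) % N  ≡⟨ cong (λ z → (c % N * z) % N) e ⟩
  (c % N * (b % N)) % N  ≡⟨ %-distribˡ-* c b N ⟨
  (c * b) % N            ∎
  where open ≡-Reasoning

[m%n+o]%n≡[m+o]%n : ∀ m o n .{{_ : NonZero n}} → (m % n + o) % n ≡ (m + o) % n
[m%n+o]%n≡[m+o]%n m o n = begin
  (m % n + o) % n            ≡⟨ %-distribˡ-+ (m % n) o n ⟩
  (m % n % n + o % n) % n    ≡⟨ cong (λ z → (z + o % n) % n) (m%n%n≡m%n m n) ⟩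
  (m % n + o % n) % n        ≡⟨ %-distribˡ-+ m o n ⟨
  (m + o) % n                ∎
  where open ≡-Reasoning

%-injective-window : ∀ {x y} n .{{_ : NonZero n}} → x < y → y < x + n → x % n ≢ y % n
%-injective-window {x} {y} n x<y y<x+n e =
  <⇒≱ (m<n+o⇒m∸n<o y x y<x+n) (∣⇒≤ {{>-nonZero (m<n⇒0<n∸m x<y)}} (divides (y / n ∸ x / n) y∸x≡))
  where
  open ≡-Reasoning
  y∸x≡ : y ∸ x ≡ (y / n ∸ x / n) * n
  y∸x≡ = begin
    y ∸ x                                    ≡⟨ cong₂ _∸_ (m≡m%n+[m/n]*n y n) (m≡m%n+[m/n]*n x n) ⟩
    (y % n + y / n * n) ∸ (x % n + x / n * n) ≡⟨ cong (λ z → (z + y / n * n) ∸ (x % n + x / n * n)) e ⟨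
    (x % n + y / n * n) ∸ (x % n + x / n * n) ≡⟨ [m+n]∸[m+o]≡n∸o (x % n) (y / n * n) (x / n * n) ⟩
    y / n * n ∸ x / n * n                    ≡⟨ *-distribʳ-∸ n (y / n) (x / n) ⟨
    (y / n ∸ x / n) * n                      ∎

least : ∀ {P : ℕ → Set} → Decidable P → ∀ {m} → P m → ∃[ s ] (s ≤ m × P s × (∀ t → t < s → ¬ P t))
least P? {zero} pm = 0 , z≤n , pm , λ _ ()
least P? {suc m} pm with P? 0
... | yes p0 = 0 , z≤n , p0 , λ _ ()
... | no ¬p0 with least (λ s → P? (suc s)) {m} pm
...   | s , s≤m , ps , below = suc s , s≤s s≤m , ps , λ { zero _ → ¬p0 ; (suc t) t<s → below t (s≤s⁻¹ t<s) }

module Lifting (n M : ℕ) .{{_ : NonZero n}} where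

  N : ℕ
  N = suc M

  Periodic : (ℕ → Fin n) → Set
  Periodic a = ∀ x y → x % N ≡ y % N → a x ≡ a y

  Periodic-shift : ∀ {a} r → Periodic a → Periodic (λ t → a (r + t))
  Periodic-shift r per x y e = per (r + x) (r + y) (+-congˡ-% r x y N e)

  record Window (b : ℕ → Fin n) (d : ℕ → ℕ) : Set where
    field
      increasing : ∀ s → s < M → d s < d (suc s)
      wraps      : d M < d 0 + n
      residue    : ∀ s → s < N → toℕ (b s) ≡ d s % n

  record Lift (b : ℕ → Fin n) (D : ℕ → ℕ) : Set where
    field
      increasing    : ∀ t → D t < D (suc t)
      quasiperiodic : ∀ t → D (t + N) ≡ D t + n
      residue       : ∀ t → toℕ (b t) ≡ D t % n

  private
    x+q*y+y≡x+[1+q]*y : ∀ x q y → x + q * y + y ≡ x + suc q * y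
    x+q*y+y≡x+[1+q]*y = solve-∀

  module _ {b d} (per : Periodic b) (Wd : Window b d) where
    open Window Wd

    extension : ℕ → ℕ
    extension t = d (t % N) + t / N * n

    extensiby-divMod : ∀ {s} q → s < N → extension (s + q * N) ≡ d s + q * n
    extensiby-divMod {s} q s<N = cong₂ (λ x y → d x + y * n) rem quot
      where
      rem : (s + q * N) % N ≡ s
      rem = trans ([m+kn]%n≡m%n s q N) (m<n⇒m%n≡m s<N)
      quot : (s + q * N) / N ≡ q
      quot = trans (+-distrib-/-∣ʳ s (n∣m*n q)) (cong₂ _+_ (m<n⇒m/n≡0 s<N) (m*n/n≡m q N))

    private
      by-divMod : ∀ (P : ℕ → Set) → (∀ s q → s < N → P (s + q * N)) → ∀ t → P t
      by-divMod P h t = subst P (sym (m≡m%n+[m/n]*n t N)) (h (t % N) (t / N) (m%n<n t N))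

      step : ∀ s q → s < N → extension (s + q * N) < extension (suc s + q * N)
      step s q s<N with m<1+n⇒m<n∨m≡n s<N
      ... | inj₁ s<M = subst₂ _<_ (sym (extensiby-divMod q s<N)) (sym (extensiby-divMod q (s≤s s<M)))
                         (+-monoˡ-< (q * n) (increasing s s<M))
      ... | inj₂ refl = subst₂ _<_ (sym (extensiby-divMod q s<N)) (sym (extensiby-divMod (suc q) (s≤s z≤n)))
                          (subst (d M + q * n <_) (+-assoc (d 0) n (q * n)) (+-monoˡ-< (q * n) wraps))

    extension-lift : Lift b extension
    extension-lift = record
      { increasing    = by-divMod (λ t → extension t < extension (suc t)) step
      ; quasiperiodic = by-divMod (λ t → extension (t + N) ≡ extension t + n) shift
      ; residue       = λ t → begin
          toℕ (b t)                  ≡⟨ cong toℕ (per t (t % N) (sym (m%n%n≡m%n t N))) ⟩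
          toℕ (b (t % N))            ≡⟨ residue (t % N) (m%n<n t N) ⟩
          d (t % N) % n              ≡⟨ [m+kn]%n≡m%n (d (t % N)) (t / N) n ⟨
          extension t % n            ∎
      }
      where
      open ≡-Reasoning
      shift : ∀ s q → s < N → extension (s + q * N + N) ≡ extension (s + q * N) + n
      shift s q s<N = begin
        extension (s + q * N + N)  ≡⟨ cong extension (x+q*y+y≡x+[1+q]*y s q N) ⟩
        extension (s + suc q * N)  ≡⟨ extensiby-divMod (suc q) s<N ⟩
        d s + suc q * n            ≡⟨ x+q*y+y≡x+[1+q]*y (d s) q n ⟨
        d s + q * n + n            ≡⟨ cong (_+ n) (extensiby-divMod q s<N) ⟨
        extension (s + q * N) + n  ∎

  module LiftProperties {b D} (L : Lift b D) where
    open Lift L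

    strict : ∀ {s t} → s < t → D s < D t
    strict {s} {suc t} s<1+t with m<1+n⇒m<n∨m≡n s<1+t
    ... | inj₁ s<t = <-trans (strict s<t) (increasing t)
    ... | inj₂ refl = increasing t

    monotone : ∀ {s t} → s ≤ t → D s ≤ D t
    monotone s≤t with m≤n⇒m<n∨m≡n s≤t
    ... | inj₁ s<t = <⇒≤ (strict s<t)
    ... | inj₂ refl = ≤-refl

    distinct-in-period : ∀ {s t} → s < t → t < s + N → b s ≢ b t
    distinct-in-period {s} {t} s<t t<s+N e =
      %-injective-window n (strict s<t) (subst (D t <_) (quasiperiodic s) (strict t<s+N))
        (trans (sym (residue s)) (trans (cong toℕ e) (residue t)))

  private
    %-of-block : ∀ q {x} → q * n ≤ x → x < q * n + n → x % n ≡ x ∸ q * n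
    %-of-block q {x} lo hi =
      trans (sym (m*n≤o⇒[o∸m*n]%n≡o%n q lo)) (m<n⇒m%n≡m (m<n+o⇒m∸n<o x (q * n) hi))

  module _ {a D} (r : ℕ) (per : Periodic a) (L : Lift (λ t → a (r + t)) D) where
    open Lift L
    open LiftProperties L

    private
      T : ℕ
      T = suc (D 0 / n) * n

      D[0]<T : D 0 < T
      D[0]<T = subst (_< T) (sym (m≡m%n+[m/n]*n (D 0) n)) (+-monoˡ-< (D 0 / n * n) (m%n<n (D 0) n))

      T≤D[N] : T ≤ D N
      T≤D[N] = subst (T ≤_) (sym (quasiperiodic 0))
        (subst (_≤ D 0 + n) (+-comm (D 0 / n * n) n) (+-monoˡ-≤ n (m/n*n≤m (D 0) n)))

    -- T is the least multiple of n above D 0.  From the first index s + 1 with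
    -- T ≤ D (s + 1) on, the next N lifted values lie in [T, T + n), where
    -- reduction mod n just subtracts T.
    clockwise : ClockwiseOrder N a
    clockwise with least (λ s → T ≤? D s) T≤D[N]
    ... | zero , _ , T≤D[0] , _ = contradiction T≤D[0] (<⇒≱ D[0]<T)
    ... | suc s , _ , T≤D[1+s] , below = (r + suc s) % N , m%n<n (r + suc s) N , increasing-from
      where
      D[s]<T : D s < T
      D[s]<T = ≰⇒> (below s ≤-refl)

      above-T : ∀ t → T ≤ D (suc s + t)
      above-T t = ≤-trans T≤D[1+s] (monotone (m≤m+n (suc s) t))

      below-T+n : ∀ t → t < N → D (suc s + t) < T + n
      below-T+n t t<N =
        ≤-<-trans (monotone (subst (suc s + t ≤_) (sym (+-suc s M)) (s≤s (+-monoʳ-≤ s (s≤s⁻¹ t<N)))))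
                  (subst (_< T + n) (sym (quasiperiodic s)) (+-monoˡ-< n D[s]<T))

      rotation : ∀ t → ((r + suc s) % N + t) % N ≡ (r + (suc s + t)) % N
      rotation t = trans ([m%n+o]%n≡[m+o]%n (r + suc s) t N) (cong (_% N) (+-assoc r (suc s) t))

      value : ∀ t → t < N → toℕ (a ((r + suc s) % N + t)) ≡ D (suc s + t) ∸ T
      value t t<N = begin
        toℕ (a ((r + suc s) % N + t))  ≡⟨ cong toℕ (per _ _ (rotation t)) ⟩
        toℕ (a (r + (suc s + t)))      ≡⟨ residue (suc s + t) ⟩
        D (suc s + t) % n              ≡⟨ %-of-block (suc (D 0 / n)) (above-T t) (below-T+n t t<N) ⟩
        D (suc s + t) ∸ T              ∎
        where open ≡-Reasoning

      increasing-from : ∀ t t′ → t < t′ → t′ < N →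
        toℕ (a ((r + suc s) % N + t)) < toℕ (a ((r + suc s) % N + t′))
      increasing-from t t′ t<t′ t′<N =
        subst₂ _<_ (sym (value t (<-trans t<t′ t′<N))) (sym (value t′ t′<N))
          (∸-monoˡ-< (strict (+-monoʳ-< (suc s) t<t′)) (above-T t))

setAt-updates : ∀ {n} ℓ (w : Tuple n ℓ) q x → setAt ℓ w q x q ≡ x
setAt-updates ℓ w q x with q ≟ q
... | yes _ = refl
... | no q≢q = contradiction refl q≢q

setAt-minimal : ∀ {n} ℓ (w : Tuple n ℓ) q x {p} → p ≢ q → setAt ℓ w q x p ≡ w p
setAt-minimal ℓ w q x {p} p≢q with p ≟ q
... | yes p≡q = contradiction p≡q p≢q
... | no _ = refl

injective-below : ∀ {A : Set} {N} (f : ℕ → A) → (∀ {s t} → s < t → t < N → f s ≢ f t) →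
                  ∀ {s t} → s < N → t < N → f s ≡ f t → s ≡ t
injective-below f distinct {s} {t} s<N t<N e with <-cmp s t
... | tri< s<t _ _ = contradiction e (distinct s<t t<N)
... | tri≈ _ s≡t _ = s≡t
... | tri> _ _ t<s = contradiction (sym e) (distinct t<s s<N)

-- ℓ + 1 is the inverse of 2 modulo 2ℓ + 1.
private
  [ℓ+1]*[i+2s] : ∀ ℓ i s → (ℓ + 1) * (i + 2 * s) ≡ (ℓ + 1) * i + s + s * suc (2 * ℓ)
  [ℓ+1]*[i+2s] = solve-∀
  2*[[ℓ+1]*x] : ∀ ℓ x → 2 * ((ℓ + 1) * x) ≡ x + x * suc (2 * ℓ)
  2*[[ℓ+1]*x] = solve-∀
  1+2[r+s] : ∀ r s → 1 + 2 * (r + s) ≡ (1 + 2 * r) + 2 * s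
  1+2[r+s] = solve-∀
  odd+[p+2ℓodd] : ∀ ℓ p r → (1 + 2 * r) + (p + 2 * ℓ * (1 + 2 * r)) ≡ p + (1 + 2 * r) * suc (2 * ℓ)
  odd+[p+2ℓodd] = solve-∀

module Tuples (n : ℕ) .{{_ : NonZero n}} (ℓ : ℕ) where
  open Lifting n (2 * ℓ) public

  oddSeq : Tuple n ℓ → ℕ → ℕ → Fin n
  oddSeq v r t = W ℓ v (1 + 2 * (r + t))

  oddSeq-periodic : ∀ v → Periodic (oddSeq v 0)
  oddSeq-periodic v x y e = cong v (%≡⇒mod≡ (1 + 2 * x) (1 + 2 * y) N (+-congˡ-% 1 (2 * x) (2 * y) N (*-congˡ-% 2 x y N e)))

  position : ℕ → ℕ → Fin N
  position i s = (i + 2 * s) mod N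

  oddSeq-position : ∀ v r s → oddSeq v r s ≡ v (position (1 + 2 * r) s)
  oddSeq-position v r s = cong (λ x → v (x mod N)) (1+2[r+s] r s)

  position-injective : ∀ i {s t} → s < N → t < N → position i s ≡ position i t → s ≡ t
  position-injective i = injective-below (position i) distinct
    where
    distinct : ∀ {s t} → s < t → t < N → position i s ≢ position i t
    distinct {s} {t} s<t t<N e = %-injective-window N (+-monoʳ-< A s<t)
      (subst (A + t <_) (sym (+-assoc A s N)) (+-monoʳ-< A (<-≤-trans t<N (m≤n+m N s))))
      (begin
        (A + s) % N                  ≡⟨ [m+kn]%n≡m%n (A + s) s N ⟨
        (A + s + s * N) % N          ≡⟨ cong (_% N) ([ℓ+1]*[i+2s] ℓ i s) ⟨
        ((ℓ + 1) * (i + 2 * s)) % N  ≡⟨ *-congˡ-% (ℓ + 1) (i + 2 * s) (i + 2 * t) N (mod≡⇒%≡ (i + 2 * s) (i + 2 * t) N e) ⟩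
        ((ℓ + 1) * (i + 2 * t)) % N  ≡⟨ cong (_% N) ([ℓ+1]*[i+2s] ℓ i t) ⟩
        (A + t + t * N) % N          ≡⟨ [m+kn]%n≡m%n (A + t) t N ⟩
        (A + t) % N                  ∎)
      where
      open ≡-Reasoning
      A : ℕ
      A = (ℓ + 1) * i

  odd-positions-cover : ∀ r (p : Fin N) → ∃[ s ] (s < N × (1 + 2 * (r + s)) mod N ≡ p)
  odd-positions-cover r p = s , m%n<n ((ℓ + 1) * x) N , toℕ-injective (trans (toℕ-mod (1 + 2 * (r + s)) N) hits)
    where
    open ≡-Reasoning
    x s : ℕ
    x = toℕ p + 2 * ℓ * (1 + 2 * r)
    s = ((ℓ + 1) * x) % N
    2s≡x : (2 * s) % N ≡ x % N
    2s≡x = begin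
      (2 * s) % N                 ≡⟨ *-congˡ-% 2 s ((ℓ + 1) * x) N (m%n%n≡m%n ((ℓ + 1) * x) N) ⟩
      (2 * ((ℓ + 1) * x)) % N     ≡⟨ cong (_% N) (2*[[ℓ+1]*x] ℓ x) ⟩
      (x + x * N) % N             ≡⟨ [m+kn]%n≡m%n x x N ⟩
      x % N                       ∎
    hits : (1 + 2 * (r + s)) % N ≡ toℕ p
    hits = begin
      (1 + 2 * (r + s)) % N           ≡⟨ cong (_% N) (1+2[r+s] r s) ⟩
      ((1 + 2 * r) + 2 * s) % N       ≡⟨ +-congˡ-% (1 + 2 * r) (2 * s) x N 2s≡x ⟩
      ((1 + 2 * r) + x) % N           ≡⟨ cong (_% N) (odd+[p+2ℓodd] ℓ (toℕ p) r) ⟩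
      (toℕ p + (1 + 2 * r) * N) % N   ≡⟨ [m+kn]%n≡m%n (toℕ p) (1 + 2 * r) N ⟩
      toℕ p % N                       ≡⟨ m<n⇒m%n≡m (toℕ<n p) ⟩
      toℕ p                           ∎

  window⇒semiValid : ∀ {v d} r → Window (oddSeq v r) d → SemiValid ℓ v
  window⇒semiValid {v} r Wd = injective , clockwise {oddSeq v 0} r (oddSeq-periodic v) L
    where
    per : Periodic (oddSeq v r)
    per = Periodic-shift {oddSeq v 0} r (oddSeq-periodic v)
    L : Lift (oddSeq v r) (extension per Wd)
    L = extension-lift per Wd
    open LiftProperties L
    injective : Injective _≡_ _≡_ v
    injective {p} {p′} e with odd-positions-cover r p | odd-positions-cover r p′
    ... | s , s<N , refl | t , t<N , refl =
      cong (λ z → (1 + 2 * (r + z)) mod N)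
        (injective-below (oddSeq v r) (λ s<t t<N → distinct-in-period s<t (<-≤-trans t<N (m≤n+m N _))) s<N t<N e)

  semiValid⇒lift : ∀ {w} → SemiValid ℓ w → ∃[ r ] ∃[ c ] Lift (oddSeq w r) c
  semiValid⇒lift {w} (_ , r , _ , inc) =
    r , _ , extension-lift (Periodic-shift {oddSeq w 0} r (oddSeq-periodic w)) (record
      { increasing = λ s s<2ℓ → inc s (suc s) (n<1+n s) (s≤s s<2ℓ)
      ; wraps      = <-≤-trans (toℕ<n _) (m≤n+m n _)
      ; residue    = λ s _ → sym (m<n⇒m%n≡m (toℕ<n _))
      })

  shiftC-outside : ∀ w i k j m {p} → (∀ s → s < k → p ≢ position i s) → shiftC n ℓ w i k j m p ≡ w p
  shiftC-outside w i zero j m _ = refl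
  shiftC-outside w i (suc k) j m {p} avoid =
    trans (setAt-minimal ℓ (shiftC n ℓ w i k j m) (position i k) _ (avoid k ≤-refl))
          (shiftC-outside w i k j m (λ s s<k → avoid s (m<n⇒m<1+n s<k)))

  shiftC-inside : ∀ w i k j m {s} → s < k → k ≤ N → shiftC n ℓ w i k j m (position i s) ≡ vtx n (j ℤ.+ + s ℤ.+ m)
  shiftC-inside w i (suc k) j m {s} s<1+k 1+k≤N with m<1+n⇒m<n∨m≡n s<1+k
  ... | inj₂ refl = setAt-updates ℓ (shiftC n ℓ w i k j m) (position i k) _
  ... | inj₁ s<k =
    trans (setAt-minimal ℓ (shiftC n ℓ w i k j m) (position i k) _
            (λ e → <-irrefl (position-injective i (<-trans s<k 1+k≤N) 1+k≤N e) s<k))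
          (shiftC-inside w i k j m s<k (<⇒≤ 1+k≤N))

private
  complement-≤ : ∀ {a b ℓ} → a + b ≤ suc (2 * ℓ) → ¬ a ≤ ℓ → b ≤ ℓ
  complement-≤ {a} {b} {ℓ} a+b≤ a≰ℓ = +-cancelˡ-≤ (suc ℓ) b ℓ
    (≤-trans (+-monoˡ-≤ b (≰⇒> a≰ℓ)) (subst (a + b ≤_) (cong (λ x → suc (ℓ + x)) (+-identityʳ ℓ)) a+b≤))

module Blocks (n : ℕ) .{{_ : NonZero n}} (ℓ : ℕ) (w : Tuple n ℓ) (r : ℕ) {c : ℕ → ℕ}
  (L : Tuples.Lift n ℓ (Tuples.oddSeq n ℓ w r) c)
  (nc : ¬ (∃[ i ] Consecutive n ℓ w i (suc (2 * ℓ)))) where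

  open Tuples n ℓ
  open Lift L
  open LiftProperties L

  UnitGap : ℕ → Set
  UnitGap t = c (suc t) ≡ suc (c t)

  UnitGap? : Decidable UnitGap
  UnitGap? t = c (suc t) ≟ℕ suc (c t)

  jump : ∀ {t} → ¬ UnitGap t → suc (c t) < c (suc t)
  jump {t} ¬unit = ≤∧≢⇒< (increasing t) (λ e → ¬unit (sym e))

  ¬UnitGap-periodic : ∀ {t} → ¬ UnitGap t → ¬ UnitGap (t + N)
  ¬UnitGap-periodic {t} ¬unit unit =
    ¬unit (+-cancelʳ-≡ n _ _ (trans (sym (quasiperiodic (suc t))) (trans unit (cong suc (quasiperiodic t)))))

  run-values : ∀ u k → (∀ s → s < k → UnitGap (u + s)) → ∀ s → s ≤ k → c (u + s) ≡ c u + s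
  run-values u k units zero _ = trans (cong c (+-identityʳ u)) (sym (+-identityʳ (c u)))
  run-values u k units (suc s) s<k = begin
    c (u + suc s)    ≡⟨ cong c (+-suc u s) ⟩
    c (suc (u + s))  ≡⟨ units s s<k ⟩
    suc (c (u + s))  ≡⟨ cong suc (run-values u k units s (<⇒≤ s<k)) ⟩
    suc (c u + s)    ≡⟨ +-suc (c u) s ⟨
    c u + suc s      ∎
    where open ≡-Reasoning

  run⇒consecutiveAt : ∀ u k → (∀ s → s < k → c (u + s) ≡ c u + s) →
                      ConsecutiveAt n ℓ w (1 + 2 * (r + u)) k (+ c u)
  run⇒consecutiveAt u k run s s<k = toℕ-injective (begin
    toℕ (w (position (1 + 2 * (r + u)) s))  ≡⟨ cong toℕ (oddSeq-position w (r + u) s) ⟨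
    toℕ (oddSeq w (r + u) s)                ≡⟨ cong (λ x → toℕ (W ℓ w (1 + 2 * x))) (+-assoc r u s) ⟩
    toℕ (oddSeq w r (u + s))                ≡⟨ residue (u + s) ⟩
    c (u + s) % n                           ≡⟨ cong (_% n) (run s s<k) ⟩
    (c u + s) % n                           ≡⟨ toℕ-vtx n (c u + s) ⟨
    toℕ (vtx n (+ c u ℤ.+ + s))             ∎)
    where open ≡-Reasoning

  nonunit-gap-within : ∀ u → ∃[ s ] (s < 2 * ℓ × ¬ UnitGap (u + s))
  nonunit-gap-within u with anyUpTo? (λ s → ¬? (UnitGap? (u + s))) (2 * ℓ)
  ... | yes found = found
  ... | no none = contradiction
    (1 + 2 * (r + u) , + c u , run⇒consecutiveAt u N (λ s s<N → run-values u (2 * ℓ) units s (s≤s⁻¹ s<N))) nc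
    where
    units : ∀ s → s < 2 * ℓ → UnitGap (u + s)
    units s s<2ℓ = decidable-stable (UnitGap? (u + s)) (λ ¬unit → none (s , s<2ℓ , ¬unit))

  record Block (p k : ℕ) : Set where
    field
      nonempty   : 1 ≤ k
      gap-before : ¬ UnitGap p
      gap-after  : ¬ UnitGap (p + k)
      run        : ∀ s → s < k → c (suc p + s) ≡ c (suc p) + s

  block-after : ∀ {p q} → p < q → ¬ UnitGap p → ¬ UnitGap q → ∃[ k ] (p + k ≤ q × Block p k)
  block-after {p} {q} p<q ¬unit-p ¬unit-q
    with least (λ s → ¬? (UnitGap? (suc p + s))) (subst (λ x → ¬ UnitGap x) (sym (m+[n∸m]≡n p<q)) ¬unit-q)
  ... | s , s≤ , ¬unit , below = suc s , ends , record
    { nonempty   = s≤s z≤n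
    ; gap-before = ¬unit-p
    ; gap-after  = subst (λ x → ¬ UnitGap x) (sym (+-suc p s)) ¬unit
    ; run        = λ t t<1+s → run-values (suc p) s units t (s≤s⁻¹ t<1+s)
    }
    where
    ends : p + suc s ≤ q
    ends = subst (_≤ q) (sym (+-suc p s)) (subst (suc p + s ≤_) (m+[n∸m]≡n p<q) (+-monoʳ-≤ (suc p) s≤))
    units : ∀ t → t < s → UnitGap (suc p + t)
    units t t<s = decidable-stable (UnitGap? (suc p + t)) (below t t<s)

  -- Two successive blocks within one period have at most N points together.
  short-block : ∃[ p ] ∃[ k ] (Block p k × k ≤ ℓ)
  short-block with nonunit-gap-within 0
  ... | p , _ , ¬unit-p with nonunit-gap-within (suc p)
  ... | s , s<2ℓ , ¬unit-1+p+s with block-after (s≤s (m≤m+n p s)) ¬unit-p ¬unit-1+p+s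
  ... | k₁ , p+k₁≤ , B₁ with block-after p+k₁<p+N (Block.gap-after B₁) (¬UnitGap-periodic ¬unit-p)
    where
    p+k₁<p+N : p + k₁ < p + N
    p+k₁<p+N = ≤-<-trans p+k₁≤ (subst (suc p + s <_) (sym (+-suc p (2 * ℓ))) (s≤s (+-monoʳ-< p s<2ℓ)))
  ... | k₂ , p+k₁+k₂≤ , B₂ with k₁ ≤? ℓ
  ... | yes k₁≤ℓ = p , k₁ , B₁ , k₁≤ℓ
  ... | no k₁≰ℓ = p + k₁ , k₂ , B₂ ,
    complement-≤ (+-cancelˡ-≤ p (k₁ + k₂) N (subst (_≤ p + N) (+-assoc p k₁ k₂) p+k₁+k₂≤)) k₁≰ℓ

  module Shift {p k} (B : Block p k) (k≤ℓ : k ≤ ℓ) where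
    open Block B

    u : ℕ
    u = suc p

    i : ℕ
    i = 1 + 2 * (r + u)

    j : ℤ
    j = + c u

    k≤2ℓ : k ≤ 2 * ℓ
    k≤2ℓ = ≤-trans k≤ℓ (m≤m+n ℓ (ℓ + 0))

    k≤N : k ≤ N
    k≤N = m≤n⇒m≤1+n k≤2ℓ

    -- The lift of the shifted tuple.
    bumped : (ℕ → ℕ) → ℕ → ℕ
    bumped f s with s <? k
    ... | yes _ = f (c (u + s))
    ... | no _ = c (u + s)

    shifted-semiValid : ∀ f m →
      (∀ s → s < k → + f (c (u + s)) ≡ + c (u + s) ℤ.+ m) →
      (∀ s → suc s < k → f (c (u + s)) < f (c (u + suc s))) →
      (∀ s → suc s ≡ k → f (c (u + s)) < c (u + suc s)) →
      c (u + 2 * ℓ) < f (c u) + n →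
      SemiValid ℓ (shiftC n ℓ w i k j m)
    shifted-semiValid f m value inside boundary wrap =
      window⇒semiValid (r + u) (record { increasing = increasing′ ; wraps = wraps′ ; residue = residue′ })
      where
      v : Tuple n ℓ
      v = shiftC n ℓ w i k j m

      increasing′ : ∀ s → s < 2 * ℓ → bumped f s < bumped f (suc s)
      increasing′ s _ with s <? k | suc s <? k
      ... | yes _ | yes 1+s<k = inside s 1+s<k
      ... | yes s<k | no 1+s≮k = boundary s (≤-antisym s<k (≮⇒≥ 1+s≮k))
      ... | no s≮k | yes 1+s<k = contradiction (<-trans (n<1+n s) 1+s<k) s≮k
      ... | no _ | no _ = strict (+-monoʳ-< u (n<1+n s))

      wraps′ : bumped f (2 * ℓ) < bumped f 0 + n
      wraps′ with 2 * ℓ <? k | 0 <? k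
      ... | yes 2ℓ<k | _ = contradiction k≤2ℓ (<⇒≱ 2ℓ<k)
      ... | no _ | no 0≮k = contradiction nonempty 0≮k
      ... | no _ | yes _ = subst (λ x → c (u + 2 * ℓ) < f (c x) + n) (sym (+-identityʳ u)) wrap

      residue′ : ∀ s → s < N → toℕ (oddSeq v (r + u) s) ≡ bumped f s % n
      residue′ s s<N with s <? k
      ... | yes s<k = begin
        toℕ (oddSeq v (r + u) s)          ≡⟨ cong toℕ (oddSeq-position v (r + u) s) ⟩
        toℕ (v (position i s))            ≡⟨ cong toℕ (shiftC-inside w i k j m s<k k≤N) ⟩
        toℕ (vtx n (j ℤ.+ + s ℤ.+ m))     ≡⟨ cong (λ x → toℕ (vtx n (+ x ℤ.+ m))) (run s s<k) ⟨
        toℕ (vtx n (+ c (u + s) ℤ.+ m))   ≡⟨ cong (λ x → toℕ (vtx n x)) (value s s<k) ⟨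
        toℕ (vtx n (+ f (c (u + s))))     ≡⟨ toℕ-vtx n (f (c (u + s))) ⟩
        f (c (u + s)) % n                 ∎
        where open ≡-Reasoning
      ... | no s≮k = begin
        toℕ (oddSeq v (r + u) s)          ≡⟨ cong toℕ (oddSeq-position v (r + u) s) ⟩
        toℕ (v (position i s))            ≡⟨ cong toℕ (shiftC-outside w i k j m outside) ⟩
        toℕ (w (position i s))            ≡⟨ cong toℕ (oddSeq-position w (r + u) s) ⟨
        toℕ (oddSeq w (r + u) s)          ≡⟨ cong (λ x → toℕ (W ℓ w (1 + 2 * x))) (+-assoc r u s) ⟩
        toℕ (oddSeq w r (u + s))          ≡⟨ residue (u + s) ⟩
        c (u + s) % n                     ∎
        where
        open ≡-Reasoning
        outside : ∀ t → t < k → position i s ≢ position i t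
        outside t t<k e = s≮k (subst (_< k) (sym (position-injective i s<N (<-≤-trans t<k k≤N) e)) t<k)

    jump-before : suc (c p) < c u
    jump-before = jump gap-before

    1≤c : ∀ s → 1 ≤ c (u + s)
    1≤c s = ≤-trans (s≤s z≤n) (≤-trans (<⇒≤ jump-before) (monotone (m≤m+n u s)))

    c[u+2ℓ]≡c[p]+n : c (u + 2 * ℓ) ≡ c p + n
    c[u+2ℓ]≡c[p]+n = trans (cong c (sym (+-suc p (2 * ℓ)))) (quasiperiodic p)

    shift-forward : SemiValid ℓ (shiftC n ℓ w i k j (+ 1))
    shift-forward = shifted-semiValid suc (+ 1)
      (λ s _ → cong +_ (+-comm 1 (c (u + s))))
      (λ s _ → s≤s (strict (+-monoʳ-< u (n<1+n s))))
      (λ { s refl → subst (λ x → suc (c x) < c (suc (p + k))) (+-suc p s) (jump gap-after) })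
      (m<n⇒m<1+n (subst (c (u + 2 * ℓ) <_) c[u+N]≡ (increasing (u + 2 * ℓ))))
      where
      c[u+N]≡ : c (suc (u + 2 * ℓ)) ≡ c u + n
      c[u+N]≡ = trans (cong c (sym (+-suc u (2 * ℓ)))) (quasiperiodic u)

    shift-backward : SemiValid ℓ (shiftC n ℓ w i k j (- (+ 1)))
    shift-backward = shifted-semiValid (_∸ 1) (- (+ 1))
      (λ s _ → sym (ℤP.⊖-≥ (1≤c s)))
      (λ s _ → ∸-monoˡ-< (strict (+-monoʳ-< u (n<1+n s))) (1≤c s))
      (λ s _ → ≤-<-trans (m∸n≤m (c (u + s)) 1) (strict (+-monoʳ-< u (n<1+n s))))
      (subst (_< c u ∸ 1 + n) (sym c[u+2ℓ]≡c[p]+n) (+-monoˡ-< n (∸-monoˡ-< jump-before (s≤s z≤n))))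

    goal : ∃[ i ] ∃[ k ] ∃[ j ] (1 ≤ k × k ≤ ℓ × ConsecutiveAt n ℓ w i k j
             × SemiValid ℓ (shiftC n ℓ w i k j (+ 1)) × SemiValid ℓ (shiftC n ℓ w i k j (- (+ 1))))
    goal = i , k , j , nonempty , k≤ℓ , run⇒consecutiveAt u k run , shift-forward , shift-backward

lemma3p11 : (n : ℕ) .{{_ : NonZero n}} (ℓ : ℕ) → 1 ≤ ℓ → (w : Tuple n ℓ) → SemiValid ℓ w
    → ¬ (∃[ i ] Consecutive n ℓ w i (suc (2 * ℓ)))
    → ∃[ i ] ∃[ k ] ∃[ j ] (1 ≤ k × k ≤ ℓ × ConsecutiveAt n ℓ w i k j
        × SemiValid ℓ (shiftC n ℓ w i k j (+ 1)) × SemiValid ℓ (shiftC n ℓ w i k j (- (+ 1))))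
lemma3p11 n ℓ _ w sv nc =
  let r , c , L       = Tuples.semiValid⇒lift n ℓ sv
      p , k , B , k≤ℓ = Blocks.short-block n ℓ w r L nc
  in  Blocks.Shift.goal n ℓ w r L nc B k≤ℓ
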